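{- Let $\mathcal F$ be a family of dangers. Then $\mathrm{obs}(\mathcal F)$ is a family of dangers. More precisely, for every $(D,x)\in\mathrm{obs}(\mathcal F)$: if $|V(D^{+x})\setminus M(D^{+x})|\ge2$ then $J_1(\mathcal F,D^{+x})$ does not hold (so $D^{+x}$ is a Maker win); otherwise $D^{+x}$ is a trivial Maker win.
   Context: A marked hypergraph $H$: finite nonempty $V(H)$, edge set $E(H)$ of nonempty subsets of $V(H)$, marked set $M(H)\subseteq V(H)$. Subhypergraph $X$: $V(X)\subseteq V(H)$, $E(X)\subseteq E(H)$, $M(X)=V(X)\cap M(H)$. $H^{+x}$ marks non-marked $x$ ($X^{+x}=X$ if $x\notin V(X)$); $H^{ -y}$ deletes $y$ and all edges containing it. Trivial Maker win: some edge $e$ with $|e\setminus M(H)|\le1$. Maker win (recursive): if $|V(H)\setminus M(H)|\le1$, iff trivial Maker win; otherwise iff some non-marked $x$ has $H^{+x-y}$ a Maker win for all non-marked $y\ne x$. Pointed marked hypergraph $(D,x)$: $x\in V(D)\setminus M(D)$; isomorphism preserves edges, marks, point. A family of dangers: family $\mathcal F$ of pointed marked hypergraphs with $D^{+x}$ a Maker win for all $(D,x)\in\mathcal F$. $x\mathcal F(H)$: subhypergraphs $X\ni x$ of $H$ with $(X,x)$ isomorphic to a member of $\mathcal F$. $\mathrm{Int}_H(\mathcal X)$: non-marked vertices of $H$ in every member of $\mathcal X$. $J_1(\mathcal F,H)$: for every non-marked $x$, $\mathrm{Int}_{H^{+x}}(x\mathcal F(H))\ne\varnothing$. $\mathrm{obs}(\mathcal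 F)$: all $(D,x)$ for which there exist $z\in V(D)\setminus(M(D)\cup\{x\})$ and a collection $\mathcal O$ of subhypergraphs of $D$ whose union (vertices, edges, marks) is $D$, such that every $X\in\mathcal O$ contains $z$ with $(X^{+x},z)$ isomorphic to a member of $\mathcal F$, and $\mathrm{Int}_{D^{+x+z}}(\mathcal O)=\varnothing$. -}

module Defs where

open import Data.Nat using (ℕ; _≤_)
open import Data.Bool using (Bool; true; false; _∧_; not)
open import Data.Fin using (Fin)
open import Data.Fin.Subset using (Subset; _∈_; _∉_; _⊆_; _∩_; _∪_; _─_; _-_; ⁅_⁆; ∣_∣; Nonempty)
open import Data.Vec using (lookup; tabulate)
open import Data.List using (List)
open import Data.List.Relation.Unary.All using (All)
open import Data.List.Relation.Unary.Any using (Any)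
open import Data.Product using (Σ; ∃; ∃-syntax; _×_; _,_)
open import Relation.Binary.PropositionalEquality using (_≡_; _≢_)
open import Relation.Nullary using (¬_)

-- All vertices live in an ambient type Fin n; the
-- vertex set V is a subset of Fin n.  (Every finite hypergraph is
-- isomorphic to one of this form.)  Edges are given by a Boolean
-- characteristic function on subsets of Fin n (so E is automatically finite).

record MH (n : ℕ) : Set where
  constructor mh
  field
    V : Subset n
    E : Subset n → Bool
    M : Subset n
open MH public

_∈E_ : ∀ {n} → Subset n → MH n → Set
e ∈E H = E H e ≡ true

WF : ∀ {n} → MH n → Set
WF H = Nonempty (V H) × (∀ e → e ∈E H → Nonempty e × e ⊆ V H) × M H ⊆ V H

Unmarked : ∀ {n} → MH n → Subset n
Unmarked H = V H ─ M H

-- H^{+x}: mark x (if x ∉ V(H) nothing changes)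
mark : ∀ {n} → Fin n → MH n → MH n
mark x H = mh (V H) (E H) (M H ∪ (V H ∩ ⁅ x ⁆))

delete : ∀ {n} → Fin n → MH n → MH n
delete y H = mh (V H - y) (λ e → E H e ∧ not (lookup e y)) (M H - y)

TrivialWin : ∀ {n} → MH n → Set
TrivialWin H = ∃[ e ] (e ∈E H × ∣ e ─ M H ∣ ≤ 1)

-- Maker win (recursive definition, as an inductive predicate; the
-- recursion is on the number of non-marked vertices)
data MakerWin {n : ℕ} : MH n → Set where
  base : ∀ {H} → ∣ Unmarked H ∣ ≤ 1 → TrivialWin H → MakerWin H
  step : ∀ {H} → 2 ≤ ∣ Unmarked H ∣ → (x : Fin n) → x ∈ Unmarked H →
         (∀ y → y ∈ Unmarked H → y ≢ x → MakerWin (delete y (mark x H))) →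
         MakerWin H

record PMH (n : ℕ) : Set where
  constructor _,ₚ_
  field
    hg : MH n
    pt : Fin n
open PMH public

IsPointed : ∀ {n} → PMH n → Set
IsPointed (D ,ₚ x) = WF D × x ∈ V D × x ∉ M D

preimage : ∀ {n m} → (Fin n → Fin m) → Subset m → Subset n
preimage f p = tabulate (λ v → lookup p (f v))

record Iso {n m : ℕ} (P : PMH n) (Q : PMH m) : Set where
  field
    f : Fin n → Fin m
    g : Fin m → Fin n
    f-V : ∀ v → v ∈ V (hg P) → f v ∈ V (hg Q)
    g-V : ∀ w → w ∈ V (hg Q) → g w ∈ V (hg P)
    gf : ∀ v → v ∈ V (hg P) → g (f v) ≡ v
    fg : ∀ w → w ∈ V (hg Q) → f (g w) ≡ w
    f-E : ∀ e → e ∈E hg P → (V (hg Q) ∩ preimage g e) ∈E hg Q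
    g-E : ∀ e → e ∈E hg Q → (V (hg P) ∩ preimage f e) ∈E hg P
    f-M : ∀ v → v ∈ V (hg P) → v ∈ M (hg P) → f v ∈ M (hg Q)
    g-M : ∀ w → w ∈ V (hg Q) → w ∈ M (hg Q) → g w ∈ M (hg P)
    f-pt : f (pt P) ≡ pt Q

Family : Set₁
Family = (m : ℕ) → PMH m → Set

InF : ∀ {n} → Family → PMH n → Set
InF F P = ∃[ m ] Σ (PMH m) (λ Q → F m Q × Iso P Q)

IsDangerFamily : Family → Set
IsDangerFamily F = ∀ m (P : PMH m) → F m P →
  IsPointed P × MakerWin (mark (pt P) (hg P))

IsSub : ∀ {n} → MH n → MH n → Set
IsSub X H = WF X × V X ⊆ V H × (∀ e → e ∈E X → e ∈E H) × M X ≡ V X ∩ M H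

xF : ∀ {n} → Family → Fin n → MH n → MH n → Set
xF F x H X = IsSub X H × x ∈ V X × InF F (X ,ₚ x)

J₁ : ∀ {n} → Family → MH n → Set
J₁ F H = ∀ x → x ∈ Unmarked H →
  ∃[ v ] (v ∈ Unmarked (mark x H) × (∀ X → xF F x H X → v ∈ V X))

obs : Family → Family
obs F m (D ,ₚ x) = IsPointed (D ,ₚ x) ×
  ∃[ z ] (z ∈ Unmarked D × z ≢ x ×
  ∃[ 𝒪 ] (All (λ X → IsSub X D × z ∈ V X × InF F (mark x X ,ₚ z)) 𝒪
    × (∀ v → v ∈ V D → Any (λ X → v ∈ V X) 𝒪)
    × (∀ e → e ∈E D → Any (λ X → e ∈E X) 𝒪)
    × (∀ v → v ∈ M D → Any (λ X → v ∈ M X) 𝒪)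
    × ¬ (∃[ v ] (v ∈ Unmarked (mark z (mark x D)) × All (λ X → v ∈ V X) 𝒪))))

-- Let (D , x) ∈ obs 𝓕 with witnesses z and 𝒪.  In D⁺ˣ Maker marks z.  Whatever
-- non-marked y Breaker then deletes, the emptiness of the intersection of 𝒪 yields some
-- X ∈ 𝒪 avoiding y; as (X⁺ˣ , z) is isomorphic to a danger, X⁺ˣ⁺ᶻ is a Maker win, and
-- it survives untouched inside D⁺ˣ⁺ᶻ⁻ʸ.  Maker wins transfer along such embeddings
-- (Maker copies his strategy), so D⁺ˣ is a Maker win.  The sets X⁺ˣ also lie in
-- z𝓕(D⁺ˣ) and share no non-marked vertex, refuting J₁ at z; and when at most one
-- vertex of D⁺ˣ is non-marked, any edge of a member of 𝒪 is already a trivial win.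

module Submission where

open import Defs
open import Data.Nat using (ℕ; suc; _≤_; _<_; z≤n; s≤s; s≤s⁻¹; _≤?_)
open import Data.Nat.Properties using (≤-trans; ≤-refl; <-≤-trans; ≰⇒>)
open import Data.Bool using (true; false)
open import Data.Fin using (Fin; zero)
open import Data.Fin.Properties using (_≟_)
open import Data.Fin.Subset
open import Data.Fin.Subset.Properties
open import Data.Vec using (_∷_; here; there; lookup)
open import Data.Vec.Properties using ([]=⇒lookup; lookup⇒[]=; lookup∘tabulate)
open import Data.List.Relation.Unary.All as All using (lookupAny)
open import Data.List.Relation.Unary.All.Properties using (¬All⇒Any¬)
open import Data.Product as Product using (∃; ∃-syntax; _×_; _,_; proj₁; proj₂)
open import Data.Sum using (_⊎_; inj₁; inj₂; [_,_]′)
open import Function using (_∘_)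
open import Relation.Binary.PropositionalEquality
open import Relation.Nullary using (¬_; yes; no; contradiction)

private
  variable
    n m : ℕ

x∈p─q⁻ : ∀ {x : Fin n} (p q : Subset n) → x ∈ p ─ q → x ∈ p × x ∉ q
x∈p─q⁻ (true ∷ p) (false ∷ q) here = here , λ ()
x∈p─q⁻ {x = zero} (s ∷ p) (true ∷ q) ()
x∈p─q⁻ (s ∷ p) (t ∷ q) (there x∈p─q) =
  Product.map there (_∘ drop-there) (x∈p─q⁻ p q x∈p─q)

x∈p-y⁻ : ∀ {x y : Fin n} (p : Subset n) → x ∈ p - y → x ∈ p × x ≢ y
x∈p-y⁻ {y = y} p = Product.map₂ x∉⁅y⁆⇒x≢y ∘ x∈p─q⁻ p ⁅ y ⁆

x∉p⇒lookup≡false : ∀ {x : Fin n} (p : Subset n) → x ∉ p → lookup p x ≡ false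
x∉p⇒lookup≡false {x = x} p x∉p with lookup p x in eq
... | false = refl
... | true  = contradiction (lookup⇒[]= x p eq) x∉p

lookup≡false⇒x∉p : ∀ {x : Fin n} {p : Subset n} → lookup p x ≡ false → x ∉ p
lookup≡false⇒x∉p eq x∈p with () ← trans (sym ([]=⇒lookup x∈p)) eq

1≤∣p∣⇒Nonempty : {p : Subset n} → 1 ≤ ∣ p ∣ → Nonempty p
1≤∣p∣⇒Nonempty {n} {p} 1≤∣p∣ with nonempty? p
... | yes p≢∅ = p≢∅
... | no p≡∅ with () ← subst (1 ≤_) (trans (cong ∣_∣ (Empty-unique p≡∅)) (∣⊥∣≡0 n)) 1≤∣p∣

x∈p∧y∈p∧x≢y⇒2≤∣p∣ : ∀ {p : Subset n} {x y} → x ∈ p → y ∈ p → x ≢ y → 2 ≤ ∣ p ∣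
x∈p∧y∈p∧x≢y⇒2≤∣p∣ {p = p} {x} {y} x∈p y∈p x≢y =
  subst (λ k → suc k ≤ ∣ p ∣) (∣⁅x⁆∣≡1 x)
    (p⊂q⇒∣p∣<∣q∣ (⁅x⁆⊆p , y , y∈p , x≢y ∘ sym ∘ x∈⁅y⁆⇒x≡y x))
  where
  ⁅x⁆⊆p : ⁅ x ⁆ ⊆ p
  ⁅x⁆⊆p w∈⁅x⁆ = subst (_∈ p) (sym (x∈⁅y⁆⇒x≡y x w∈⁅x⁆)) x∈p

∣p∣≤1⇒x∈p∧y∈p⇒x≡y : ∀ {p : Subset n} {x y} → ∣ p ∣ ≤ 1 → x ∈ p → y ∈ p → x ≡ y
∣p∣≤1⇒x∈p∧y∈p⇒x≡y {x = x} {y} ∣p∣≤1 x∈p y∈p with x ≟ y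
... | yes x≡y = x≡y
... | no x≢y with s≤s () ← ≤-trans (x∈p∧y∈p∧x≢y⇒2≤∣p∣ x∈p y∈p x≢y) ∣p∣≤1

Empty[p-x]⇒p⊆⁅x⁆ : ∀ {p : Subset n} {x} → Empty (p - x) → p ⊆ ⁅ x ⁆
Empty[p-x]⇒p⊆⁅x⁆ {x = x} p-x≡∅ {w} w∈p with w ≟ x
... | yes refl = x∈⁅x⁆ x
... | no w≢x   = contradiction (w , x∈p∧x≢y⇒x∈p-y w∈p w≢x) p-x≡∅

2≤∣p∣⇒∃≢ : ∀ {p : Subset n} {x} → 2 ≤ ∣ p ∣ → x ∈ p → ∃[ y ] (y ∈ p × y ≢ x)
2≤∣p∣⇒∃≢ {p = p} {x} 2≤∣p∣ x∈p with nonempty? (p - x)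
... | yes (y , y∈p-x) = y , x∈p-y⁻ p y∈p-x
... | no p-x≡∅ with s≤s () ←
  ≤-trans 2≤∣p∣ (subst (∣ p ∣ ≤_) (∣⁅x⁆∣≡1 x) (p⊆q⇒∣p∣≤∣q∣ (Empty[p-x]⇒p⊆⁅x⁆ p-x≡∅)))

2≤∣p∣⇒∃₂≢ : ∀ {p : Subset n} → 2 ≤ ∣ p ∣ → ∃[ x ] ∃[ y ] (x ∈ p × y ∈ p × y ≢ x)
2≤∣p∣⇒∃₂≢ 2≤∣p∣ with 1≤∣p∣⇒Nonempty (≤-trans (s≤s z≤n) 2≤∣p∣)
... | x , x∈p = x , Product.map₂ (x∈p ,_) (2≤∣p∣⇒∃≢ 2≤∣p∣ x∈p)

unique⇒∣p∣≤1 : ∀ {p : Subset n} → (∀ {x y} → x ∈ p → y ∈ p → x ≡ y) → ∣ p ∣ ≤ 1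
unique⇒∣p∣≤1 {p = p} unique with 2 ≤? ∣ p ∣
... | no 2≰∣p∣ = s≤s⁻¹ (≰⇒> 2≰∣p∣)
... | yes 2≤∣p∣ with 2≤∣p∣⇒∃₂≢ 2≤∣p∣
... | x , y , x∈p , y∈p , y≢x = contradiction (unique y∈p x∈p) y≢x

module _ (H : MH n) where

  ∈M-mark⁻ : ∀ {x w} → w ∈ M (mark x H) → w ∈ M H ⊎ (w ∈ V H × w ≡ x)
  ∈M-mark⁻ {x} w∈M with x∈p∪q⁻ (M H) (V H ∩ ⁅ x ⁆) w∈M
  ... | inj₁ w∈M = inj₁ w∈M
  ... | inj₂ w∈V∩⁅x⁆ = inj₂ (Product.map₂ (x∈⁅y⁆⇒x≡y x) (x∈p∩q⁻ (V H) ⁅ x ⁆ w∈V∩⁅x⁆))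

  ∈M-mark⁺ : ∀ {x w} → w ∈ M H → w ∈ M (mark x H)
  ∈M-mark⁺ w∈M = x∈p∪q⁺ (inj₁ w∈M)

  ∈Unmarked⁻ : ∀ {w} → w ∈ Unmarked H → w ∈ V H × w ∉ M H
  ∈Unmarked⁻ = x∈p─q⁻ (V H) (M H)

  ∈Unmarked⁺ : ∀ {w} → w ∈ V H → w ∉ M H → w ∈ Unmarked H
  ∈Unmarked⁺ = x∈p∧x∉q⇒x∈p─q

module _ (H : MH n) where

  x∈M-mark-x : ∀ {x} → x ∈ V H → x ∈ M (mark x H)
  x∈M-mark-x {x} x∈V = x∈p∪q⁺ (inj₂ (x∈p∩q⁺ (x∈V , x∈⁅x⁆ x)))

  ∈Unmarked-mark⁺ : ∀ {x w} → w ∈ Unmarked H → w ≢ x → w ∈ Unmarked (mark x H)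
  ∈Unmarked-mark⁺ {x} w∈U w≢x with ∈Unmarked⁻ H w∈U
  ... | w∈V , w∉M = ∈Unmarked⁺ (mark x H) w∈V ([ w∉M , w≢x ∘ proj₂ ]′ ∘ ∈M-mark⁻ H)

  ∈Unmarked-mark⁻ : ∀ {x w} → w ∈ Unmarked (mark x H) → w ∈ Unmarked H × w ≢ x
  ∈Unmarked-mark⁻ {x} w∈U with ∈Unmarked⁻ (mark x H) w∈U
  ... | w∈V , w∉M′ = ∈Unmarked⁺ H w∈V (w∉M′ ∘ ∈M-mark⁺ H) , λ { refl → w∉M′ (x∈M-mark-x w∈V) }

  ∈E-delete⁻ : ∀ {y e} → e ∈E delete y H → e ∈E H × y ∉ e
  ∈E-delete⁻ {y} {e} e∈E with E H e | lookup e y in y∈?e | e∈E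
  ... | true | false | _ = refl , lookup≡false⇒x∉p y∈?e

  ∈E-delete⁺ : ∀ {y e} → e ∈E H → y ∉ e → e ∈E delete y H
  ∈E-delete⁺ {y} {e} e∈E y∉e rewrite e∈E | x∉p⇒lookup≡false e y∉e = refl

Unmarked-play⊆ : ∀ (H : MH n) {x y} → Unmarked (delete y (mark x H)) ⊆ Unmarked H - x
Unmarked-play⊆ H {x} {y} w∈U′ with ∈Unmarked⁻ (delete y (mark x H)) w∈U′
... | w∈V-y , w∉M′-y with x∈p-y⁻ (V H) w∈V-y
... | w∈V , w≢y =
  Product.uncurry x∈p∧x≢y⇒x∈p-y
    (∈Unmarked-mark⁻ H (∈Unmarked⁺ (mark x H) w∈V (w∉M′-y ∘ λ w∈M′ → x∈p∧x≢y⇒x∈p-y w∈M′ w≢y)))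

∣Unmarked-play∣<∣Unmarked∣ : ∀ (H : MH n) {x y} → x ∈ Unmarked H →
  ∣ Unmarked (delete y (mark x H)) ∣ < ∣ Unmarked H ∣
∣Unmarked-play∣<∣Unmarked∣ H {x} {y} x∈U =
  <-≤-trans (s≤s (p⊆q⇒∣p∣≤∣q∣ (Unmarked-play⊆ H {x} {y}))) (x∈p⇒∣p-x∣<∣p∣ x∈U)

WinningEdge : MH n → Subset n → Set
WinningEdge H e = e ∈E H × e ⊆ V H × ∣ e ─ M H ∣ ≤ 1

WinningEdge-play : ∀ {H : MH n} {e x y} → WinningEdge H e → y ∉ e → WinningEdge (delete y (mark x H)) e
WinningEdge-play {H = H} {e} {x} {y} (e∈E , e⊆V , ∣e─M∣≤1) y∉e =
  ∈E-delete⁺ (mark x H) e∈E y∉e , (λ w∈e → x∈p∧x≢y⇒x∈p-y (e⊆V w∈e) (≢y w∈e)) ,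
  ≤-trans (p⊆q⇒∣p∣≤∣q∣ e─M′⊆e─M) ∣e─M∣≤1
  where
  ≢y : ∀ {w} → w ∈ e → w ≢ y
  ≢y w∈e refl = y∉e w∈e
  e─M′⊆e─M : e ─ M (delete y (mark x H)) ⊆ e ─ M H
  e─M′⊆e─M w∈e─M′ with x∈p─q⁻ e (M (delete y (mark x H))) w∈e─M′
  ... | w∈e , w∉M′ =
    x∈p∧x∉q⇒x∈p─q w∈e λ w∈M → w∉M′ (x∈p∧x≢y⇒x∈p-y (∈M-mark⁺ H w∈M) (≢y w∈e))

-- Maker marks the unmarked vertex of the edge, if any, so Breaker can never delete the edge.
winningEdge-move : ∀ {H : MH n} {e} → WinningEdge H e → Nonempty (Unmarked H) →
  ∃[ x ] (x ∈ Unmarked H × (∀ {y} → y ∈ Unmarked H → y ≢ x → y ∉ e))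
winningEdge-move {H = H} {e} (_ , e⊆V , ∣e─M∣≤1) (x₀ , x₀∈U) with nonempty? (e ─ M H)
... | yes (x , x∈e─M) with x∈p─q⁻ e (M H) x∈e─M
...   | x∈e , x∉M = x , ∈Unmarked⁺ H (e⊆V x∈e) x∉M ,
          λ y∈U y≢x y∈e →
            y≢x (∣p∣≤1⇒x∈p∧y∈p⇒x≡y ∣e─M∣≤1 (x∈p∧x∉q⇒x∈p─q y∈e (proj₂ (∈Unmarked⁻ H y∈U))) x∈e─M)
winningEdge-move {H = H} {e} _ (x₀ , x₀∈U) | no e─M≡∅ =
  x₀ , x₀∈U , λ {y} y∈U _ y∈e → e─M≡∅ (y , x∈p∧x∉q⇒x∈p─q y∈e (proj₂ (∈Unmarked⁻ H y∈U)))

winningEdge⇒MakerWin : ∀ {H : MH n} {e} → WinningEdge H e → MakerWin H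
winningEdge⇒MakerWin {H = H} = bounded (suc ∣ Unmarked H ∣) ≤-refl
  where
  bounded : ∀ k {H : MH n} {e} → ∣ Unmarked H ∣ < k → WinningEdge H e → MakerWin H
  bounded (suc k) {H} (s≤s bound) win@(e∈E , _ , ∣e─M∣≤1) with 2 ≤? ∣ Unmarked H ∣
  ... | no 2≰∣U∣ = base (s≤s⁻¹ (≰⇒> 2≰∣U∣)) (_ , e∈E , ∣e─M∣≤1)
  ... | yes 2≤∣U∣ with winningEdge-move {H = H} win (1≤∣p∣⇒Nonempty (≤-trans (s≤s z≤n) 2≤∣U∣))
  ...   | x , x∈U , others∉e = step 2≤∣U∣ x x∈U λ y y∈U y≢x →
          bounded k (<-≤-trans (∣Unmarked-play∣<∣Unmarked∣ H x∈U) bound)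
            (WinningEdge-play {H = H} {x = x} {y} win (others∉e y∈U y≢x))

-- A copy of A inside B, up to shrinking edges: every edge of A contains the
-- (pulled back) vertices of some edge of B, and B's marks on the copy are exactly A's.
record Embedding (A : MH m) (B : MH n) : Set where
  field
    to      : Fin m → Fin n
    from    : Fin n → Fin m
    to-V    : ∀ {v} → v ∈ V A → to v ∈ V B
    from-to : ∀ {v} → v ∈ V A → from (to v) ≡ v
    to-from : ∀ {w} → w ∈ V B → from w ∈ V A → to (from w) ≡ w
    E⊆V     : ∀ {e} → e ∈E A → e ⊆ V A
    to-E    : ∀ {e} → e ∈E A → ∃[ e′ ] (e′ ∈E B × (∀ {w} → w ∈ e′ → from w ∈ e × to (from w) ≡ w))
    to-M    : ∀ {v} → v ∈ V A → v ∈ M A → to v ∈ M B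
    to-M⁻   : ∀ {v} → v ∈ V A → to v ∈ M B → v ∈ M A

  to-injective : ∀ {u v} → u ∈ V A → v ∈ V A → to u ≡ to v → u ≡ v
  to-injective {u} {v} u∈V v∈V tu≡tv = begin
    u           ≡⟨ from-to u∈V ⟨
    from (to u) ≡⟨ cong from tu≡tv ⟩
    from (to v) ≡⟨ from-to v∈V ⟩
    v           ∎
    where open ≡-Reasoning

  to-Unmarked : ∀ {v} → v ∈ Unmarked A → to v ∈ Unmarked B
  to-Unmarked v∈U with ∈Unmarked⁻ A v∈U
  ... | v∈V , v∉M = ∈Unmarked⁺ B (to-V v∈V) (v∉M ∘ to-M⁻ v∈V)

  to-2≤∣Unmarked∣ : 2 ≤ ∣ Unmarked A ∣ → 2 ≤ ∣ Unmarked B ∣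
  to-2≤∣Unmarked∣ 2≤∣U∣ with 2≤∣p∣⇒∃₂≢ 2≤∣U∣
  ... | u , v , u∈U , v∈U , v≢u = x∈p∧y∈p∧x≢y⇒2≤∣p∣ (to-Unmarked u∈U) (to-Unmarked v∈U)
          (v≢u ∘ sym ∘ to-injective (proj₁ (∈Unmarked⁻ A u∈U)) (proj₁ (∈Unmarked⁻ A v∈U)))

  to-TrivialWin : TrivialWin A → ∃ (WinningEdge B)
  to-TrivialWin (e , e∈E , ∣e─M∣≤1) with to-E e∈E
  ... | e′ , e′∈E , pulled = e′ , e′∈E , e′⊆V , unique⇒∣p∣≤1 unique
    where
    e′⊆V : e′ ⊆ V B
    e′⊆V w∈e′ with pulled w∈e′
    ... | fw∈e , tfw≡w = subst (_∈ V B) tfw≡w (to-V (E⊆V e∈E fw∈e))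
    from-∈e─M : ∀ {w} → w ∈ e′ ─ M B → from w ∈ e ─ M A
    from-∈e─M w∈e′─M with x∈p─q⁻ e′ (M B) w∈e′─M
    ... | w∈e′ , w∉M with pulled w∈e′
    ... | fw∈e , tfw≡w = x∈p∧x∉q⇒x∈p─q fw∈e (w∉M ∘ subst (_∈ M B) tfw≡w ∘ to-M (E⊆V e∈E fw∈e))
    unique : ∀ {u w} → u ∈ e′ ─ M B → w ∈ e′ ─ M B → u ≡ w
    unique {u} {w} u∈ w∈ = begin
      u                ≡⟨ proj₂ (pulled (proj₁ (x∈p─q⁻ e′ (M B) u∈))) ⟨
      to (from u)      ≡⟨ cong to (∣p∣≤1⇒x∈p∧y∈p⇒x≡y ∣e─M∣≤1 (from-∈e─M u∈) (from-∈e─M w∈)) ⟩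
      to (from w)      ≡⟨ proj₂ (pulled (proj₁ (x∈p─q⁻ e′ (M B) w∈))) ⟩
      w                ∎
      where open ≡-Reasoning

open Embedding

module _ {A : MH m} {B : MH n} (φ : Embedding A B) where

  Embedding-mark : ∀ {x} → x ∈ V A → Embedding (mark x A) (mark (to φ x) B)
  Embedding-mark {x} x∈V = record
    { to = to φ ; from = from φ ; to-V = to-V φ ; from-to = from-to φ ; to-from = to-from φ
    ; E⊆V = E⊆V φ ; to-E = to-E φ ; to-M = to-M′ ; to-M⁻ = to-M⁻′ }
    where
    to-M′ : ∀ {v} → v ∈ V A → v ∈ M (mark x A) → to φ v ∈ M (mark (to φ x) B)
    to-M′ v∈V v∈M′ with ∈M-mark⁻ A v∈M′
    ... | inj₁ v∈M        = ∈M-mark⁺ B (to-M φ v∈V v∈M)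
    ... | inj₂ (_ , refl) = x∈M-mark-x B (to-V φ v∈V)
    to-M⁻′ : ∀ {v} → v ∈ V A → to φ v ∈ M (mark (to φ x) B) → v ∈ M (mark x A)
    to-M⁻′ v∈V tv∈M′ with ∈M-mark⁻ B tv∈M′
    ... | inj₁ tv∈M       = ∈M-mark⁺ A (to-M⁻ φ v∈V tv∈M)
    ... | inj₂ (_ , tv≡tx) rewrite to-injective φ v∈V x∈V tv≡tx = x∈M-mark-x A x∈V

  Embedding-delete : ∀ {y′ y} → (∀ {v} → v ∈ V A → to φ v ≡ y → v ≡ y′) →
    Embedding (delete y′ A) (delete y B)
  Embedding-delete {y′} {y} only-y′↦y = record
    { to      = to φ
    ; from    = from φ
    ; to-V    = λ v∈V′ → to-∉y (to-V φ (∈V v∈V′)) v∈V′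
    ; from-to = from-to φ ∘ ∈V
    ; to-from = λ w∈V′ fw∈V′ → to-from φ (proj₁ (x∈p-y⁻ (V B) w∈V′)) (∈V fw∈V′)
    ; E⊆V     = E⊆V′
    ; to-E    = to-E′
    ; to-M    = λ v∈V′ v∈M′ → to-∉y (to-M φ (∈V v∈V′) (proj₁ (x∈p-y⁻ (M A) v∈M′))) v∈V′
    ; to-M⁻   = λ v∈V′ tv∈M′ → x∈p∧x≢y⇒x∈p-y (to-M⁻ φ (∈V v∈V′) (proj₁ (x∈p-y⁻ (M B) tv∈M′)))
                                               (proj₂ (x∈p-y⁻ (V A) v∈V′))
    }
    where
    ∈V : ∀ {v} → v ∈ V A - y′ → v ∈ V A
    ∈V = proj₁ ∘ x∈p-y⁻ (V A)
    to-∉y : ∀ {p v} → to φ v ∈ p → v ∈ V A - y′ → to φ v ∈ p - y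
    to-∉y tv∈p v∈V′ with x∈p-y⁻ (V A) v∈V′
    ... | v∈V , v≢y′ = x∈p∧x≢y⇒x∈p-y tv∈p (v≢y′ ∘ only-y′↦y v∈V)
    E⊆V′ : ∀ {e} → e ∈E delete y′ A → e ⊆ V A - y′
    E⊆V′ e∈E′ w∈e with ∈E-delete⁻ A e∈E′
    ... | e∈E , y′∉e = x∈p∧x≢y⇒x∈p-y (E⊆V φ e∈E w∈e) λ { refl → y′∉e w∈e }
    to-E′ : ∀ {e} → e ∈E delete y′ A →
      ∃[ e′ ] (e′ ∈E delete y B × (∀ {w} → w ∈ e′ → from φ w ∈ e × to φ (from φ w) ≡ w))
    to-E′ e∈E′ with ∈E-delete⁻ A e∈E′
    ... | e∈E , y′∉e with to-E φ e∈E
    ... | e′ , e′∈E , pulled = e′ , ∈E-delete⁺ B e′∈E y∉e′ , pulled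
      where
      y∉e′ : y ∉ e′
      y∉e′ y∈e′ with pulled y∈e′
      ... | fy∈e , tfy≡y = y′∉e (subst (_∈ _) (only-y′↦y (E⊆V φ e∈E fy∈e) tfy≡y) fy∈e)

makerWin-transport : {A : MH m} {B : MH n} → Embedding A B → MakerWin A → MakerWin B
makerWin-transport φ (base _ win) = winningEdge⇒MakerWin (proj₂ (to-TrivialWin φ win))
makerWin-transport {A = A} {B} φ (step 2≤∣U∣ x x∈U next) with 2 ≤? ∣ Unmarked B ∣
... | no 2≰∣U′∣ = contradiction (to-2≤∣Unmarked∣ φ 2≤∣U∣) 2≰∣U′∣
... | yes 2≤∣U′∣ = step 2≤∣U′∣ (to φ x) (to-Unmarked φ x∈U) answer
  where
  x∈V : x ∈ V A
  x∈V = proj₁ (∈Unmarked⁻ A x∈U)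
  answer : ∀ y → y ∈ Unmarked B → y ≢ to φ x → MakerWin (delete y (mark (to φ x) B))
  answer y y∈U y≢tx with from φ y ∈? V A
  ... | yes fy∈V =
    makerWin-transport (Embedding-delete (Embedding-mark φ x∈V) only-fy↦y) (next (from φ y) fy∈U fy≢x)
    where
    y∈V : y ∈ V B
    y∈V = proj₁ (∈Unmarked⁻ B y∈U)
    tfy≡y : to φ (from φ y) ≡ y
    tfy≡y = to-from φ y∈V fy∈V
    fy∈U : from φ y ∈ Unmarked A
    fy∈U = ∈Unmarked⁺ A fy∈V (proj₂ (∈Unmarked⁻ B y∈U) ∘ subst (_∈ M B) tfy≡y ∘ to-M φ fy∈V)
    fy≢x : from φ y ≢ x
    fy≢x fy≡x = y≢tx (trans (sym tfy≡y) (cong (to φ) fy≡x))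
    only-fy↦y : ∀ {v} → v ∈ V A → to φ v ≡ y → v ≡ from φ y
    only-fy↦y v∈V refl = sym (from-to φ v∈V)
  -- Breaker deleted a vertex outside the copy of A: Maker answers as if any other vertex of A
  -- had been deleted.
  ... | no fy∉V with 2≤∣p∣⇒∃≢ 2≤∣U∣ x∈U
  ...   | y′ , y′∈U , y′≢x =
    makerWin-transport (Embedding-delete (Embedding-mark φ x∈V) nothing↦y) (next y′ y′∈U y′≢x)
    where
    nothing↦y : ∀ {v} → v ∈ V A → to φ v ≡ y → v ≡ y′
    nothing↦y v∈V refl = contradiction (subst (_∈ V A) (sym (from-to φ v∈V)) v∈V) fy∉V

module _ {X H : MH n} where

  IsSub⇒M⊆M : IsSub X H → M X ⊆ M H
  IsSub⇒M⊆M (_ , _ , _ , M≡V∩M) w∈M = proj₂ (x∈p∩q⁻ (V X) (M H) (subst (_ ∈_) M≡V∩M w∈M))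

  IsSub-mark : ∀ {x} → IsSub X H → IsSub (mark x X) (mark x H)
  IsSub-mark {x} X⊆H@((V≢∅ , E⊆V , M⊆V) , V⊆V , E⊆E , M≡V∩M) =
    (V≢∅ , E⊆V , M′⊆V) , V⊆V , E⊆E , ⊆-antisym M′⊆V∩M′ V∩M′⊆M′
    where
    M′⊆V : M (mark x X) ⊆ V X
    M′⊆V w∈M′ with ∈M-mark⁻ X w∈M′
    ... | inj₁ w∈M       = M⊆V w∈M
    ... | inj₂ (w∈V , _) = w∈V
    M′⊆V∩M′ : M (mark x X) ⊆ V X ∩ M (mark x H)
    M′⊆V∩M′ w∈M′ with ∈M-mark⁻ X w∈M′
    ... | inj₁ w∈M          = x∈p∩q⁺ (M⊆V w∈M , ∈M-mark⁺ H (IsSub⇒M⊆M X⊆H w∈M))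
    ... | inj₂ (w∈V , refl) = x∈p∩q⁺ (w∈V , x∈M-mark-x H (V⊆V w∈V))
    V∩M′⊆M′ : V X ∩ M (mark x H) ⊆ M (mark x X)
    V∩M′⊆M′ {w} w∈V∩M′ with x∈p∩q⁻ (V X) (M (mark x H)) w∈V∩M′
    ... | w∈V , w∈M′ with ∈M-mark⁻ H w∈M′
    ... | inj₁ w∈M       = ∈M-mark⁺ X (subst (w ∈_) (sym M≡V∩M) (x∈p∩q⁺ (w∈V , w∈M)))
    ... | inj₂ (_ , refl) = x∈M-mark-x X w∈V

  IsSub⇒Embedding-delete : ∀ {y} → IsSub X H → y ∉ V X → Embedding X (delete y H)
  IsSub⇒Embedding-delete {y} X⊆H@((_ , E⊆V , _) , V⊆V , E⊆E , M≡V∩M) y∉V = record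
    { to      = λ v → v
    ; from    = λ w → w
    ; to-V    = λ v∈V → x∈p∧x≢y⇒x∈p-y (V⊆V v∈V) (≢y v∈V)
    ; from-to = λ _ → refl
    ; to-from = λ _ _ → refl
    ; E⊆V     = λ {e} → proj₂ ∘ E⊆V e
    ; to-E    = λ {e} e∈E →
        e , ∈E-delete⁺ H (E⊆E e e∈E) (y∉V ∘ proj₂ (E⊆V e e∈E)) , λ w∈e → w∈e , refl
    ; to-M    = λ v∈V v∈M → x∈p∧x≢y⇒x∈p-y (IsSub⇒M⊆M X⊆H v∈M) (≢y v∈V)
    ; to-M⁻   = λ {v} v∈V v∈M-y →
        subst (v ∈_) (sym M≡V∩M) (x∈p∩q⁺ (v∈V , proj₁ (x∈p-y⁻ (M H) v∈M-y)))
    }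
    where
    ≢y : ∀ {v} → v ∈ V X → v ≢ y
    ≢y v∈V refl = y∉V v∈V

Iso⇒Embedding : ∀ {P : PMH n} {Q : PMH m} → Iso P Q → WF (hg Q) → pt P ∈ V (hg P) →
  Embedding (mark (pt Q) (hg Q)) (mark (pt P) (hg P))
Iso⇒Embedding {P = H ,ₚ z} {Q = G ,ₚ q} iso (_ , E⊆V , _) z∈V = record
  { to      = g
  ; from    = f
  ; to-V    = g-V _
  ; from-to = fg _
  ; to-from = λ v∈V _ → gf _ v∈V
  ; E⊆V     = λ {e} → proj₂ ∘ E⊆V e
  ; to-E    = λ {e} e∈E → V H ∩ preimage f e , g-E e e∈E , pulled
  ; to-M    = to-M′
  ; to-M⁻   = to-M⁻′
  }
  where
  open Iso iso
  pulled : ∀ {e w} → w ∈ V H ∩ preimage f e → f w ∈ e × g (f w) ≡ w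
  pulled {e} {w} w∈V∩f⁻¹e with x∈p∩q⁻ (V H) (preimage f e) w∈V∩f⁻¹e
  ... | w∈V , w∈f⁻¹e =
    lookup⇒[]= (f w) e (trans (sym (lookup∘tabulate (lookup e ∘ f) w)) ([]=⇒lookup w∈f⁻¹e)) , gf w w∈V
  gq≡z : g q ≡ z
  gq≡z = trans (cong g (sym f-pt)) (gf z z∈V)
  to-M′ : ∀ {w} → w ∈ V G → w ∈ M (mark q G) → g w ∈ M (mark z H)
  to-M′ {w} w∈V w∈M′ with ∈M-mark⁻ G w∈M′
  ... | inj₁ w∈M        = ∈M-mark⁺ H (g-M w w∈V w∈M)
  ... | inj₂ (_ , refl) = subst (_∈ M (mark z H)) (sym gq≡z) (x∈M-mark-x H z∈V)
  to-M⁻′ : ∀ {w} → w ∈ V G → g w ∈ M (mark z H) → w ∈ M (mark q G)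
  to-M⁻′ {w} w∈V gw∈M′ with ∈M-mark⁻ H gw∈M′
  ... | inj₁ gw∈M = ∈M-mark⁺ G (subst (_∈ M G) (fg w w∈V) (f-M (g w) (g-V w w∈V) gw∈M))
  ... | inj₂ (_ , gw≡z) = subst (_∈ M (mark q G)) q≡w (x∈M-mark-x G (subst (_∈ V G) (sym q≡w) w∈V))
    where
    q≡w : q ≡ w
    q≡w = trans (sym f-pt) (trans (cong f (sym gw≡z)) (fg w w∈V))

InF⇒MakerWin : ∀ {F} {P : PMH n} → IsDangerFamily F → InF F P → pt P ∈ V (hg P) →
  MakerWin (mark (pt P) (hg P))
InF⇒MakerWin dangers (_ , Q , Q∈F , iso) pt∈V with dangers _ Q Q∈F
... | (WF-Q , _) , win = makerWin-transport (Iso⇒Embedding iso WF-Q pt∈V) win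

MakerWin⇒∃edge : ∀ {H : MH n} → MakerWin H → ∃[ e ] (e ∈E H)
MakerWin⇒∃edge (base _ (e , e∈E , _)) = e , e∈E
MakerWin⇒∃edge {H = H} (step 2≤∣U∣ x x∈U next) with 2≤∣p∣⇒∃≢ 2≤∣U∣ x∈U
... | y , y∈U , y≢x = Product.map₂ (proj₁ ∘ ∈E-delete⁻ (mark x H)) (MakerWin⇒∃edge (next y y∈U y≢x))

module _ {F : Family} {D : MH n} {x : Fin n} where

  obs⇒¬J₁ : obs F n (D ,ₚ x) → ¬ J₁ F (mark x D)
  obs⇒¬J₁ (_ , z , z∈U , z≢x , _ , members , _ , _ , _ , ⋂𝒪≡∅) J₁-holds
    with J₁-holds z (∈Unmarked-mark⁺ D z∈U z≢x)
  ... | v , v∈U , v∈all =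
    ⋂𝒪≡∅ (v , v∈U , All.map (λ {X} (X⊆D , z∈X , X∈F) → v∈all (mark x X) (IsSub-mark X⊆D , z∈X , X∈F))
                            members)

  obs⇒TrivialWin : IsDangerFamily F → obs F n (D ,ₚ x) →
    ∣ Unmarked (mark x D) ∣ ≤ 1 → TrivialWin (mark x D)
  obs⇒TrivialWin dangers ((((v , v∈V) , E⊆V , _) , _) , _ , _ , _ , _ , members , cover , _) ∣U∣≤1
    with lookupAny members (cover v v∈V)
  ... | (X⊆D , z∈X , X∈F) , _ with MakerWin⇒∃edge (InF⇒MakerWin dangers X∈F z∈X)
  ... | e , e∈X = e , e∈D , ≤-trans (p⊆q⇒∣p∣≤∣q∣ e─M⊆U) ∣U∣≤1
    where
    e∈D : e ∈E D
    e∈D = proj₁ (proj₂ (proj₂ X⊆D)) e e∈X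
    e─M⊆U : e ─ M (mark x D) ⊆ Unmarked (mark x D)
    e─M⊆U w∈e─M with x∈p─q⁻ e (M (mark x D)) w∈e─M
    ... | w∈e , w∉M = ∈Unmarked⁺ (mark x D) (proj₂ (E⊆V e e∈D) w∈e) w∉M

  obs⇒MakerWin : IsDangerFamily F → obs F n (D ,ₚ x) → MakerWin (mark x D)
  obs⇒MakerWin dangers o with 2 ≤? ∣ Unmarked (mark x D) ∣
  ... | no 2≰∣U∣ = base ∣U∣≤1 (obs⇒TrivialWin dangers o ∣U∣≤1)
    where
    ∣U∣≤1 : ∣ Unmarked (mark x D) ∣ ≤ 1
    ∣U∣≤1 = s≤s⁻¹ (≰⇒> 2≰∣U∣)
  obs⇒MakerWin dangers (_ , z , z∈U , z≢x , 𝒪 , members , _ , _ , _ , ⋂𝒪≡∅) | yes 2≤∣U∣ =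
    step 2≤∣U∣ z (∈Unmarked-mark⁺ D z∈U z≢x) answer
    where
    answer : ∀ y → y ∈ Unmarked (mark x D) → y ≢ z → MakerWin (delete y (mark z (mark x D)))
    answer y y∈U y≢z with lookupAny members
      (¬All⇒Any¬ (λ X → y ∈? V X) 𝒪 λ y∈⋂𝒪 → ⋂𝒪≡∅ (y , ∈Unmarked-mark⁺ (mark x D) y∈U y≢z , y∈⋂𝒪))
    ... | (X⊆D , z∈X , X∈F) , y∉X =
      makerWin-transport (IsSub⇒Embedding-delete (IsSub-mark (IsSub-mark X⊆D)) y∉X)
                         (InF⇒MakerWin dangers X∈F z∈X)

mainTheorem15 : (F : Family) → IsDangerFamily F →
    IsDangerFamily (obs F) ×
    (∀ m (P : PMH m) → obs F m P →
      (2 ≤ ∣ Unmarked (mark (pt P) (hg P)) ∣ → ¬ J₁ F (mark (pt P) (hg P))) ×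
      (∣ Unmarked (mark (pt P) (hg P)) ∣ ≤ 1 → TrivialWin (mark (pt P) (hg P))))
mainTheorem15 F dangers =
  (λ { _ (D ,ₚ x) o → proj₁ o , obs⇒MakerWin dangers o }) ,
  (λ { _ (D ,ₚ x) o → (λ _ → obs⇒¬J₁ o) , obs⇒TrivialWin dangers o })
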